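{- Let $R=(Z,A(R))$ be a finite digraph, let $X, M\subseteq Z$ be disjoint, let $Y\subseteq Z$ with $M\cap Y=\emptyset$ and $M\cap N_R(y)=\emptyset$ for all $y\in Y$, and let $\beta:X\to Y$ be a map. Let $S$ be the digraph with $V(S)=Z$ and $A(S)=A_r\cup A_d\cup A_u$, where $A_r=A(R)\setminus((M\times X)\cup(X\times M))$, $A_d=\{m\beta(x): mx\in A(R)\cap(M\times X)\}$, $A_u=\{\beta(x)m: xm\in A(R)\cap(X\times M)\}$. Assume moreover that $\beta$ is a bijective homomorphism from $R|_X$ to $R|_Y$ and that for every $x\in X$, $$N^{in}_R(x)\setminus M\subseteq N^{in}_R(\beta(x)) \quad\text{and}\quad N^{out}_R(x)\setminus M\subseteq N^{out}_R(\beta(x)).$$ For every finite digraph $G$ and every $\xi\in\mathcal{S}(G,R)$ let $U_\xi=\{v\in V(G): \xi(v)\in X \text{ and } \xi[N_G(v)]\cap M\neq\emptyset\}$ and define $\rho_G(\xi):V(G)\to Z$ by $\rho_G(\xi)(v)=\beta(\xi(v))$ if $v\in U_\xi$ and $\rho_G(\xi)(v)=\xi(v)$ otherwise; for $\zeta\in\mathcal{S}(G,S)$ let $U'_\zeta=\{v\in V(G): \zeta(v)\in Y \text{ and } \zeta[N_G(v)]\cap M\neq\emptyset\}$. Then for every finite digraph $G$ and every $\xi\in\mathcal{S}(G,R)$ we have $\rho_G(\xi)\in\mathcal{S}(G,S)$ and, for all $v\in V(G)$, $$\xi(v)=\begin{cases}\beta^{ -1}(\rho_G(\xi)(v)) &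 \text{if } v\in U'_{\rho_G(\xi)},\\ \rho_G(\xi)(v) & \text{otherwise};\end{cases}$$ in particular $\rho_G:\mathcal{S}(G,R)\to\mathcal{S}(G,S)$ is injective, and $R\sqsubseteq_\Gamma S$ with respect to the class $\mathfrak{D}$ of all finite digraphs.
   Context: A digraph $G=(V(G),A(G))$ has a finite non-empty vertex set and arc set $A(G)\subseteq V(G)\times V(G)$; $vw$ denotes $(v,w)$. Arcs $vv$ are loops, arcs $vw$ with $v\ne w$ are proper; $G^*$ is $G$ with loops removed. For $X\subseteq V(G)$ non-empty, $G|_X=(X,A(G)\cap(X\times X))$. $v,w$ are adjacent if $vw\in A(G)$ or $wv\in A(G)$; $N_G(v)$ is the set of $w\ne v$ adjacent to $v$, $N^{in}_G(v)=\{w\in N_G(v): wv\in A(G)\}$, $N^{out}_G(v)=\{w\in N_G(v): vw\in A(G)\}$. A homomorphism $\xi:G\to H$ is a map $V(G)\to V(H)$ with $\xi(v)\xi(w)\in A(H)$ for all $vw\in A(G)$; $\mathcal{H}(G,H)$ is the set of these; strict homomorphisms map proper arcs to proper arcs, and $\mathcal{S}(G,H)$ denotes the set of strict homomorphisms. For $X\subseteq V(G)$, $v\in X$, $\gamma_X(v)$ is the set of $w\in X$ with $w=v$ or joined to $v$ by a sequence in $X$ of consecutively adjacent vertices; for a map $\xi$ on $V(G)$, $\Gamma_\xi(v)=\gamma_{\xi^{ -1}(\xi(v))}(v)$. For a class $\mathfrak{D}'$ of digraphs with representative system $\mathfrak{D}'_r$ up to isomorphism, $R\sqsubseteq_\Gamma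 S$ with respect to $\mathfrak{D}'$ means that there exist injective maps $\rho_G:\mathcal{H}(G,R)\to\mathcal{H}(G,S)$, $G\in\mathfrak{D}'_r$, with $\Gamma_{\rho_G(\xi)}(v)=\Gamma_\xi(v)$ for all $G\in\mathfrak{D}'_r$, $\xi\in\mathcal{H}(G,R)$, $v\in V(G)$. -}

module Defs where

open import Data.Nat using (ℕ)
open import Data.Fin using (Fin; _≟_)
open import Data.Fin.Properties using (any?)
open import Data.Bool using (Bool; T)
open import Data.Product using (Σ; _×_; _,_; proj₁; proj₂)
open import Data.Sum using (_⊎_)
open import Relation.Nullary using (¬_; Dec; yes; no)
open import Relation.Nullary.Decidable using (_×-dec_; _⊎-dec_; ¬?; T?)
open import Relation.Binary.PropositionalEquality using (_≡_; _≢_)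
open import Function.Bundles using (_⇔_)
open import Function.Definitions using (Bijective)

record Digraph : Set where
  constructor digraph
  field
    size : ℕ
    arc  : Fin size → Fin size → Bool

Vtx : Digraph → Set
Vtx G = Fin (Digraph.size G)

Arc : (G : Digraph) → Vtx G → Vtx G → Set
Arc G v w = T (Digraph.arc G v w)

ARel : ℕ → Set₁
ARel n = Fin n → Fin n → Set

Sub : ℕ → Set
Sub n = Fin n → Bool

⟨_⟩ : ∀ {n} → Sub n → Set
⟨ X ⟩ = Σ _ (λ z → T (X z))

module _ {n : ℕ} (E : ARel n) where
  Adj : Fin n → Fin n → Set
  Adj v w = E v w ⊎ E w v
  InN : Fin n → Fin n → Set
  InN v w = (w ≢ v) × Adj v w
  InNin : Fin n → Fin n → Set
  InNin v w = InN v w × E w v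
  InNout : Fin n → Fin n → Set
  InNout v w = InN v w × E v w

  -- Reach P v w : w = v, or w is joined to v by a sequence of
  -- consecutively adjacent vertices, all lying in P (with v ∈ P assumed
  -- by the caller).
  data Reach (P : Fin n → Set) (v : Fin n) : Fin n → Set where
    start : Reach P v v
    step  : ∀ {u w} → Reach P v u → Adj u w → P w → Reach P v w

IsHom : ∀ {a b} → ARel a → ARel b → (Fin a → Fin b) → Set
IsHom E F ξ = ∀ v w → E v w → F (ξ v) (ξ w)

IsStrict : ∀ {a b} → ARel a → ARel b → (Fin a → Fin b) → Set
IsStrict E F ξ = IsHom E F ξ × (∀ v w → E v w → v ≢ w → ξ v ≢ ξ w)

HomSet : ∀ {a b} → ARel a → ARel b → Set
HomSet E F = Σ (Fin _ → Fin _) (IsHom E F)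

InΓ : ∀ {a b} → ARel a → (Fin a → Fin b) → Fin a → Fin a → Set
InΓ E ξ v w = Reach E (λ u → ξ u ≡ ξ v) v w

-- R ⊑_Γ S with respect to the class of all finite digraphs
-- (representatives: all digraphs with vertex set Fin k).
-- Maps are compared pointwise (they are finite functions).
_⊑Γ_ : ∀ {r s} → ARel r → ARel s → Set
R ⊑Γ S = (G : Digraph) →
  Σ (HomSet (Arc G) R → HomSet (Arc G) S) λ ρ →
    (∀ ξ₁ ξ₂ → (∀ v → proj₁ (ρ ξ₁) v ≡ proj₁ (ρ ξ₂) v) →
               ∀ v → proj₁ ξ₁ v ≡ proj₁ ξ₂ v)
  × (∀ ξ v w → InΓ (Arc G) (proj₁ (ρ ξ)) v w ⇔ InΓ (Arc G) (proj₁ ξ) v w)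

module Construction (R : Digraph) (X M Y : Sub (Digraph.size R))
                    (β : ⟨ X ⟩ → ⟨ Y ⟩) where
  Z : Set
  Z = Vtx R

  AR : ARel (Digraph.size R)
  AR = Arc R

  Ar Ad Au : Z → Z → Set
  Ar v w = AR v w × ¬ ((T (M v) × T (X w)) ⊎ (T (X v) × T (M w)))
  Ad v w = Σ ⟨ X ⟩ λ x → T (M v) × AR v (proj₁ x) × proj₁ (β x) ≡ w
  Au v w = Σ ⟨ X ⟩ λ x → T (M w) × AR (proj₁ x) w × proj₁ (β x) ≡ v

  AS : ARel (Digraph.size R)
  AS v w = Ar v w ⊎ Ad v w ⊎ Au v w

  HitsM : (G : Digraph) → (Vtx G → Z) → Vtx G → Set
  HitsM G ζ v = Σ (Vtx G) λ w → InN (Arc G) v w × T (M (ζ w))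

  U : (G : Digraph) → (Vtx G → Z) → Vtx G → Set
  U G ξ v = T (X (ξ v)) × HitsM G ξ v

  U′ : (G : Digraph) → (Vtx G → Z) → Vtx G → Set
  U′ G ζ v = T (Y (ζ v)) × HitsM G ζ v

  U? : (G : Digraph) → (ξ : Vtx G → Z) → (v : Vtx G) → Dec (U G ξ v)
  U? G ξ v = T? (X (ξ v)) ×-dec any? (λ w →
               (¬? (w ≟ v) ×-dec (T? (Digraph.arc G v w) ⊎-dec T? (Digraph.arc G w v)))
               ×-dec T? (M (ξ w)))

  ρ : (G : Digraph) → (Vtx G → Z) → Vtx G → Z
  ρ G ξ v with U? G ξ v
  ... | yes (px , _) = proj₁ (β (ξ v , px))
  ... | no _ = ξ v

  β⁻¹ : Bijective _≡_ _≡_ β → ⟨ Y ⟩ → ⟨ X ⟩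
  β⁻¹ bij y = proj₁ (proj₂ bij y)

-- ρ_G(ξ) moves v from ξ(v) ∈ X to β(ξ(v)) ∈ Y exactly when v has a neighbour
-- mapped into M.  Arcs of G between a moved vertex and an M-vertex land on the
-- rerouted arcs A_d, A_u of S, and all other arcs at a moved vertex land on arcs
-- of R because β(x) inherits the neighbours of x outside M; so ρ_G(ξ) is a
-- homomorphism into S, and it stays strict because β(x) is never the image of
-- a neighbour of x.  As no vertex of Y has a neighbour in M, v was moved iff
-- ρ_G(ξ)(v) ∈ Y and v has a neighbour mapped into M by ρ_G(ξ), which decodes ξ.
-- For arbitrary homomorphisms the same argument works when v is moved as soon
-- as some vertex of its class Γ_ξ(v) sees M: this condition is constant on the
-- fibres inside a class, so the classes of ρ_G(ξ) and ξ coincide.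
module Submission where

open import Defs
open import Data.Bool using (T)
open import Data.Bool.Properties using (T-irrelevant)
open import Data.Product using (Σ-syntax; _×_; _,_; proj₁; proj₂)
open import Data.Sum using (_⊎_; inj₁; inj₂; swap; map)
open import Data.Empty using (⊥-elim)
open import Data.Nat using (ℕ)
open import Data.Fin using (Fin; _≟_)
open import Data.Fin.Properties using (any?)
open import Data.Fin.Subset using (Subset; _∈_; _⊆_; _⊃_)
open import Data.Fin.Subset.Properties using (_∈?_; _⊂?_)
open import Data.Fin.Subset.Induction using (Acc; acc; ⊃-wellFounded)
open import Data.Vec using (tabulate)
open import Data.Vec.Properties using (lookup∘tabulate; []=⇒lookup; lookup⇒[]=)
open import Relation.Nullary using (¬_; Dec; yes; no; does; contradiction)
open import Relation.Nullary.Decidable using (map′; dec-true; T?; ¬?; _×-dec_; _⊎-dec_)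
open import Relation.Binary.PropositionalEquality
  using (_≡_; _≢_; refl; sym; trans; cong; subst; subst₂)
open import Function using (_∘_; id)
open import Function.Bundles using (_⇔_; mk⇔; Equivalence)
open import Function.Definitions using (Bijective)

open Equivalence using (to; from)

⟨⟩-≡ : ∀ {n} {S : Sub n} {a b : ⟨ S ⟩} → proj₁ a ≡ proj₁ b → a ≡ b
⟨⟩-≡ {S = S} {z , p} {.z , q} refl = cong (z ,_) (T-irrelevant p q)

fromDec : ∀ {n} {P : Fin n → Set} → (∀ a → Dec (P a)) → Subset n
fromDec P? = tabulate (does ∘ P?)

module _ {n : ℕ} {P : Fin n → Set} (P? : ∀ a → Dec (P a)) where

  ∈-fromDec⁺ : ∀ {a} → P a → a ∈ fromDec P?
  ∈-fromDec⁺ {a} pa = lookup⇒[]= a _ (trans (lookup∘tabulate (does ∘ P?) a) (dec-true (P? a) pa))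

  ∈-fromDec⁻ : ∀ {a} → a ∈ fromDec P? → P a
  ∈-fromDec⁻ {a} a∈ with P? a | trans (sym (lookup∘tabulate (does ∘ P?) a)) ([]=⇒lookup a∈)
  ... | yes pa | _ = pa
  ... | no _ | ()

module _ {a : ℕ} {E : ARel a} where

  InΓ-fibre : ∀ {b} {f : Fin a → Fin b} {v w} → InΓ E f v w → f w ≡ f v
  InΓ-fibre start = refl
  InΓ-fibre (step _ _ p) = p

  InΓ-trans : ∀ {b} {f : Fin a → Fin b} {u v w} → InΓ E f u v → InΓ E f v w → InΓ E f u w
  InΓ-trans r start = r
  InΓ-trans r (step r′ adj p) = step (InΓ-trans r r′) adj (trans p (InΓ-fibre r))

  InΓ-transfer : ∀ {b c} {f : Fin a → Fin b} {g : Fin a → Fin c} →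
                 (∀ {u w} → Adj E u w → f u ≡ f w → g u ≡ g w) →
                 ∀ {v w} → InΓ E f v w → InΓ E g v w
  InΓ-transfer f⇒g start = start
  InΓ-transfer f⇒g (step r adj p) =
    step (InΓ-transfer f⇒g r) adj
         (trans (sym (f⇒g adj (trans (InΓ-fibre r) (sym p)))) (InΓ-fibre (InΓ-transfer f⇒g r)))

  InΓ-resp-≗ : ∀ {b} {f g : Fin a → Fin b} → (∀ v → f v ≡ g v) →
               ∀ {v w} → InΓ E f v w → InΓ E g v w
  InΓ-resp-≗ f≗g = InΓ-transfer λ {u} {w} _ eq → trans (sym (f≗g u)) (trans eq (f≗g w))

module _ {a b : ℕ} {E : ARel a} {F : ARel b} {f : Fin a → Fin b} (strict : IsStrict E F f) where

  strict-fibre-adj : ∀ {u w} → Adj E u w → f u ≡ f w → u ≡ w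
  strict-fibre-adj {u} {w} adj eq with u ≟ w | adj
  ... | yes u≡w | _ = u≡w
  ... | no u≢w | inj₁ e = contradiction eq (proj₂ strict u w e u≢w)
  ... | no u≢w | inj₂ e = contradiction (sym eq) (proj₂ strict w u e (u≢w ∘ sym))

  InΓ-strict : ∀ {v w} → InΓ E f v w → w ≡ v
  InΓ-strict start = refl
  InΓ-strict (step r adj p) =
    trans (sym (strict-fibre-adj adj (trans (InΓ-fibre r) (sym p)))) (InΓ-strict r)

-- The vertices from which Q is reachable form the least set containing Q and
-- closed under backward steps; it is computed by saturation, which terminates
-- because a strictly growing chain of subsets of Fin n is finite.
module _ {n : ℕ} {E : ARel n} (E? : ∀ u w → Dec (E u w))
         {P Q : Fin n → Set} (P? : ∀ u → Dec (P u)) (Q? : ∀ u → Dec (Q u)) where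

  Reaches : Fin n → Set
  Reaches v = Σ[ u ∈ Fin n ] Reach E P v u × Q u

  private
    Step : Fin n → Fin n → Set
    Step u w = Adj E u w × P w

    step? : ∀ u w → Dec (Step u w)
    step? u w = (E? u w ⊎-dec E? w u) ×-dec P? w

    StepClosed : Subset n → Set
    StepClosed C = ∀ {u w} → Step u w → w ∈ C → u ∈ C

    Reach-cons : ∀ {u w x} → Step u w → Reach E P w x → Reach E P u x
    Reach-cons (adj , pw) start = step start adj pw
    Reach-cons st (step r adj p) = step (Reach-cons st r) adj p

    Reach-into : ∀ {C} → StepClosed C → ∀ {v u} → Reach E P v u → u ∈ C → v ∈ C
    Reach-into closed start u∈C = u∈C
    Reach-into closed (step r adj p) w∈C = Reach-into closed r (closed (adj , p) w∈C)

    grows? : (S : Subset n) → ∀ u → Dec (u ∈ S ⊎ Σ[ w ∈ Fin n ] Step u w × w ∈ S)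
    grows? S u = (u ∈? S) ⊎-dec any? λ w → step? u w ×-dec (w ∈? S)

    grow : Subset n → Subset n
    grow S = fromDec (grows? S)

    ⊆-grow : ∀ {S} → S ⊆ grow S
    ⊆-grow u∈S = ∈-fromDec⁺ (grows? _) (inj₁ u∈S)

    grow-step : ∀ {S u w} → Step u w → w ∈ S → u ∈ grow S
    grow-step st w∈S = ∈-fromDec⁺ (grows? _) (inj₂ (_ , st , w∈S))

    grow-sound : ∀ {S} → (∀ {u} → u ∈ S → Reaches u) → ∀ {u} → u ∈ grow S → Reaches u
    grow-sound S⊆R u∈ with ∈-fromDec⁻ (grows? _) u∈
    ... | inj₁ u∈S = S⊆R u∈S
    ... | inj₂ (w , st , w∈S) with S⊆R w∈S
    ...   | x , r , qx = x , Reach-cons st r , qx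

    saturate : (S : Subset n) → Acc _⊃_ S → (∀ {u} → u ∈ S → Reaches u) →
               Σ[ C ∈ Subset n ] (S ⊆ C) × StepClosed C × (∀ {u} → u ∈ C → Reaches u)
    saturate S (acc rec) S⊆R with S ⊂? grow S
    ... | yes S⊂grow with saturate (grow S) (rec S⊂grow) (grow-sound S⊆R)
    ...   | C , grow⊆C , closed , C⊆R = C , (grow⊆C ∘ ⊆-grow) , closed , C⊆R
    saturate S _ S⊆R | no S⊄grow = S , id , (λ st w∈S → grow⊆S (grow-step st w∈S)) , S⊆R
      where
      grow⊆S : grow S ⊆ S
      grow⊆S {u} u∈grow with u ∈? S
      ... | yes u∈S = u∈S
      ... | no u∉S = contradiction ((λ {_} → ⊆-grow) , u , u∈grow , u∉S) S⊄grow

  reaches? : ∀ v → Dec (Reaches v)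
  reaches? v with saturate (fromDec Q?) (⊃-wellFounded _) (λ u∈Q → _ , start , ∈-fromDec⁻ Q? u∈Q)
  ... | C , Q⊆C , closed , C⊆R = map′ C⊆R (λ (u , r , qu) → Reach-into closed r (Q⊆C (∈-fromDec⁺ Q? qu))) (v ∈? C)

module Rerouting (R : Digraph) (X M Y : Sub (Digraph.size R))
    (X∩M≡∅ : ∀ z → T (X z) → ¬ T (M z))
    (M∩Y≡∅ : ∀ z → T (M z) → ¬ T (Y z))
    (M∩N[Y]≡∅ : ∀ y m → T (Y y) → T (M m) → ¬ InN (Arc R) y m)
    (β : ⟨ X ⟩ → ⟨ Y ⟩)
    (bij : Bijective _≡_ _≡_ β)
    (β-hom : ∀ x x′ → Arc R (proj₁ x) (proj₁ x′) → Arc R (proj₁ (β x)) (proj₁ (β x′)))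
    (β-Nin : ∀ (x : ⟨ X ⟩) u → InNin (Arc R) (proj₁ x) u → ¬ T (M u) → InNin (Arc R) (proj₁ (β x)) u)
    (β-Nout : ∀ (x : ⟨ X ⟩) u → InNout (Arc R) (proj₁ x) u → ¬ T (M u) → InNout (Arc R) (proj₁ (β x)) u)
    where
  open Construction R X M Y β

  β-¬M : ∀ x → ¬ T (M (proj₁ (β x)))
  β-¬M x m = M∩Y≡∅ _ m (proj₂ (β x))

  β-cong : ∀ {z z′} (p : T (X z)) (q : T (X z′)) → z ≡ z′ → proj₁ (β (z , p)) ≡ proj₁ (β (z′ , q))
  β-cong p q eq = cong (proj₁ ∘ β) (⟨⟩-≡ eq)

  β-injective : ∀ {x x′} → proj₁ (β x) ≡ proj₁ (β x′) → proj₁ x ≡ proj₁ x′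
  β-injective eq = cong proj₁ (proj₁ bij (⟨⟩-≡ eq))

  β⁻¹-unique : ∀ x y → proj₁ (β x) ≡ proj₁ y → proj₁ x ≡ proj₁ (β⁻¹ bij y)
  β⁻¹-unique x y eq = β-injective (trans eq (cong proj₁ (sym (proj₂ (proj₂ bij y) refl))))

  AS-β : ∀ x x′ → AR (proj₁ x) (proj₁ x′) → AS (proj₁ (β x)) (proj₁ (β x′))
  AS-β x x′ e = inj₁ (β-hom x x′ e , λ { (inj₁ (m , _)) → β-¬M x m ; (inj₂ (_ , m)) → β-¬M x′ m })

  AS-β-out : ∀ x {z} → z ≢ proj₁ x → AR (proj₁ x) z → AS (proj₁ (β x)) z
  AS-β-out x {z} z≢x e with T? (M z)
  ... | yes m = inj₂ (inj₂ (x , m , e , refl))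
  ... | no ¬m = inj₁ (proj₂ (β-Nout x z ((z≢x , inj₁ e) , e) ¬m) ,
                      λ { (inj₁ (m , _)) → β-¬M x m ; (inj₂ (_ , m)) → ¬m m })

  AS-β-in : ∀ x {z} → z ≢ proj₁ x → AR z (proj₁ x) → AS z (proj₁ (β x))
  AS-β-in x {z} z≢x e with T? (M z)
  ... | yes m = inj₂ (inj₁ (x , m , e , refl))
  ... | no ¬m = inj₁ (proj₂ (β-Nin x z ((z≢x , inj₂ e) , e) ¬m) ,
                      λ { (inj₁ (m , _)) → ¬m m ; (inj₂ (_ , m)) → β-¬M x m })

  β-≢-neighbour : ∀ x {z} → z ≢ proj₁ x → Adj AR (proj₁ x) z → z ≢ proj₁ (β x)
  β-≢-neighbour x {z} z≢x adj z≡βx = z≢βx adj z≡βx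
    where
    ¬m : ¬ T (M z)
    ¬m m = β-¬M x (subst (T ∘ M) z≡βx m)

    -- z is then a neighbour of β x, and neighbourhoods exclude the vertex itself.
    z≢βx : Adj AR (proj₁ x) z → z ≢ proj₁ (β x)
    z≢βx (inj₁ e) = proj₁ (proj₁ (β-Nout x z ((z≢x , inj₁ e) , e) ¬m))
    z≢βx (inj₂ e) = proj₁ (proj₁ (β-Nin x z ((z≢x , inj₂ e) , e) ¬m))

  HitsM? : ∀ G ζ v → Dec (HitsM G ζ v)
  HitsM? G ζ v = any? λ w → (¬? (w ≟ v) ×-dec (T? (Digraph.arc G v w) ⊎-dec T? (Digraph.arc G w v)))
                            ×-dec T? (M (ζ w))

  -- U and U′ with N_G(v) replaced by the neighbourhood of the class Γ_ζ(v);
  -- for strict homomorphisms Γ_ζ(v) = {v} and they agree with U and U′.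
  UΓ U′Γ : (G : Digraph) → (Vtx G → Z) → Vtx G → Set
  UΓ G ξ v = T (X (ξ v)) × Σ[ u ∈ Vtx G ] InΓ (Arc G) ξ v u × HitsM G ξ u
  U′Γ G ζ v = T (Y (ζ v)) × Σ[ u ∈ Vtx G ] InΓ (Arc G) ζ v u × HitsM G ζ u

  UΓ? : ∀ G ξ v → Dec (UΓ G ξ v)
  UΓ? G ξ v = T? (X (ξ v)) ×-dec reaches? {E = Arc G} (λ a b → T? (Digraph.arc G a b))
                                          (λ u → ξ u ≟ ξ v) (HitsM? G ξ) v

  U⇒UΓ : ∀ {G ξ v} → U G ξ v → UΓ G ξ v
  U⇒UΓ (x , h) = x , _ , start , h

  UΓ-fibre-closed : ∀ {G ξ a b} → Adj (Arc G) a b → ξ a ≡ ξ b → UΓ G ξ a → UΓ G ξ b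
  UΓ-fibre-closed adj eq (x , u , r , h) = subst (T ∘ X) eq x , u , InΓ-trans (step start (swap adj) eq) r , h

  U′Γ-resp-≗ : ∀ {G ζ₁ ζ₂} → (∀ v → ζ₁ v ≡ ζ₂ v) → ∀ {v} → U′Γ G ζ₁ v → U′Γ G ζ₂ v
  U′Γ-resp-≗ ζ≗ (y , u , r , w , n , m) =
    subst (T ∘ Y) (ζ≗ _) y , u , InΓ-resp-≗ ζ≗ r , w , n , subst (T ∘ M) (ζ≗ w) m

  U′Γ⇔U′ : ∀ {G F ζ} → IsStrict (Arc G) F ζ → ∀ {v} → U′Γ G ζ v ⇔ U′ G ζ v
  U′Γ⇔U′ {G} {F} {ζ} strict =
    mk⇔ (λ (y , u , r , h) → y , subst (HitsM G ζ) (InΓ-strict {F = F} strict r) h) (λ (y , h) → y , _ , start , h)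

  ρΓ : (G : Digraph) → (Vtx G → Z) → Vtx G → Z
  ρΓ G ξ v with UΓ? G ξ v
  ... | yes (x , _) = proj₁ (β (ξ v , x))
  ... | no _ = ξ v

  record Relabels (G : Digraph) (ξ ρ′ : Vtx G → Z) (W : Vtx G → Set) : Set where
    field
      at : ∀ v → (W v × Σ[ x ∈ T (X (ξ v)) ] ρ′ v ≡ proj₁ (β (ξ v , x))) ⊎ (¬ W v × ρ′ v ≡ ξ v)

  ρ-relabels : ∀ {G ξ} → Relabels G ξ (ρ G ξ) (U G ξ)
  Relabels.at (ρ-relabels {G} {ξ}) v with U? G ξ v
  ... | yes u = inj₁ (u , proj₁ u , refl)
  ... | no ¬u = inj₂ (¬u , refl)

  ρΓ-relabels : ∀ {G ξ} → Relabels G ξ (ρΓ G ξ) (UΓ G ξ)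
  Relabels.at (ρΓ-relabels {G} {ξ}) v with UΓ? G ξ v
  ... | yes u = inj₁ (u , proj₁ u , refl)
  ... | no ¬u = inj₂ (¬u , refl)

  module _ {G ξ ρ′ W} (rel : Relabels G ξ ρ′ W) where

    relabel-M : ∀ w → T (M (ρ′ w)) ⇔ T (M (ξ w))
    relabel-M w with Relabels.at rel w
    ... | inj₁ (_ , x , e) = mk⇔ (λ m → ⊥-elim (β-¬M _ (subst (T ∘ M) e m)))
                                 (λ m → ⊥-elim (X∩M≡∅ _ x m))
    ... | inj₂ (_ , e) = mk⇔ (subst (T ∘ M) e) (subst (T ∘ M) (sym e))

    relabel-HitsM : ∀ {u} → HitsM G ρ′ u ⇔ HitsM G ξ u
    relabel-HitsM = mk⇔ (λ (w , n , m) → w , n , to (relabel-M w) m)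
                        (λ (w , n , m) → w , n , from (relabel-M w) m)

    relabel-recover-β : ∀ {v} → W v → (y : T (Y (ρ′ v))) → ξ v ≡ proj₁ (β⁻¹ bij (ρ′ v , y))
    relabel-recover-β {v} Wv y with Relabels.at rel v
    ... | inj₁ (_ , x , e) = β⁻¹-unique (ξ v , x) (ρ′ v , y) (sym e)
    ... | inj₂ (¬Wv , _) = contradiction Wv ¬Wv

    relabel-recover-id : ∀ {v} → ¬ W v → ξ v ≡ ρ′ v
    relabel-recover-id {v} ¬Wv with Relabels.at rel v
    ... | inj₁ (Wv , _) = contradiction Wv ¬Wv
    ... | inj₂ (_ , e) = sym e

  relabel-injective : ∀ {G ξ₁ ξ₂ ρ₁ ρ₂ W₁ W₂} →
    Relabels G ξ₁ ρ₁ W₁ → Relabels G ξ₂ ρ₂ W₂ →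
    (∀ {v} → W₁ v ⇔ U′Γ G ρ₁ v) → (∀ {v} → W₂ v ⇔ U′Γ G ρ₂ v) →
    (∀ v → ρ₁ v ≡ ρ₂ v) → ∀ v → ξ₁ v ≡ ξ₂ v
  relabel-injective rel₁ rel₂ W₁⇔ W₂⇔ ρ≗ v with Relabels.at rel₁ v | Relabels.at rel₂ v
  ... | inj₁ (_ , _ , e₁) | inj₁ (_ , _ , e₂) = β-injective (trans (sym e₁) (trans (ρ≗ v) e₂))
  ... | inj₂ (_ , e₁) | inj₂ (_ , e₂) = trans (sym e₁) (trans (ρ≗ v) e₂)
  ... | inj₁ (W₁v , _) | inj₂ (¬W₂v , _) =
    contradiction (from W₂⇔ (U′Γ-resp-≗ ρ≗ (to W₁⇔ W₁v))) ¬W₂v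
  ... | inj₂ (¬W₁v , _) | inj₁ (W₂v , _) =
    contradiction (from W₁⇔ (U′Γ-resp-≗ (sym ∘ ρ≗) (to W₂⇔ W₂v))) ¬W₁v

  module Relabelling (G : Digraph) (ξ : Vtx G → Z) (hom : IsHom (Arc G) AR ξ)
      (W : Vtx G → Set) (ρ′ : Vtx G → Z) (rel : Relabels G ξ ρ′ W)
      (U⇒W : ∀ {v} → U G ξ v → W v) (W⇒UΓ : ∀ {v} → W v → UΓ G ξ v)
      (W-fibre-closed : ∀ {a b} → Adj (Arc G) a b → ξ a ≡ ξ b → W a → W b) where

    ¬W⇒¬M-neighbour : ∀ {v w} → Adj (Arc G) v w → T (X (ξ v)) → ¬ W v → ¬ T (M (ξ w))
    ¬W⇒¬M-neighbour {v} {w} adj x ¬Wv m with ξ w ≟ ξ v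
    ... | yes eq = X∩M≡∅ _ x (subst (T ∘ M) eq m)
    ... | no ne = ¬Wv (U⇒W (x , w , (ne ∘ cong ξ , adj) , m))

    ξ-Adj : ∀ {v w} → Adj (Arc G) v w → Adj AR (ξ v) (ξ w)
    ξ-Adj = map (hom _ _) (hom _ _)

    Y-¬hitsM : ∀ {u} → T (Y (ξ u)) → ¬ HitsM G ξ u
    Y-¬hitsM y (w , (_ , adj) , m) =
      M∩N[Y]≡∅ _ _ y m ((λ eq → M∩Y≡∅ _ m (subst (T ∘ Y) (sym eq) y)) , ξ-Adj adj)

    ρ′-hom : IsHom (Arc G) AS ρ′
    ρ′-hom v w e with Relabels.at rel v | Relabels.at rel w
    ... | inj₁ (_ , x , ev) | inj₁ (_ , x′ , ew) =
      subst₂ AS (sym ev) (sym ew) (AS-β (_ , x) (_ , x′) (hom v w e))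
    ... | inj₁ (Wv , x , ev) | inj₂ (¬Ww , ew) =
      subst₂ AS (sym ev) (sym ew) (AS-β-out (_ , x) (λ eq → ¬Ww (W-fibre-closed (inj₁ e) (sym eq) Wv)) (hom v w e))
    ... | inj₂ (¬Wv , ev) | inj₁ (Ww , x′ , ew) =
      subst₂ AS (sym ev) (sym ew) (AS-β-in (_ , x′) (λ eq → ¬Wv (W-fibre-closed (inj₂ e) (sym eq) Ww)) (hom v w e))
    ... | inj₂ (¬Wv , ev) | inj₂ (¬Ww , ew) =
      subst₂ AS (sym ev) (sym ew) (inj₁ (hom v w e ,
        λ { (inj₁ (m , x)) → ¬W⇒¬M-neighbour (inj₂ e) x ¬Ww m
          ; (inj₂ (x , m)) → ¬W⇒¬M-neighbour (inj₁ e) x ¬Wv m }))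

    fibre-from-β : ∀ {a b} (x : T (X (ξ a))) → Adj (Arc G) a b → ξ b ≡ proj₁ (β (ξ a , x)) → ξ a ≡ ξ b
    fibre-from-β {a} {b} x adj eq with ξ a ≟ ξ b
    ... | yes e = e
    ... | no ne = contradiction eq (β-≢-neighbour (ξ a , x) (ne ∘ sym) (ξ-Adj adj))

    ρ′-fibre⁺ : ∀ {a b} → Adj (Arc G) a b → ξ a ≡ ξ b → ρ′ a ≡ ρ′ b
    ρ′-fibre⁺ {a} {b} adj eq with Relabels.at rel a | Relabels.at rel b
    ... | inj₁ (_ , x , ea) | inj₁ (_ , x′ , eb) = trans ea (trans (β-cong x x′ eq) (sym eb))
    ... | inj₂ (_ , ea) | inj₂ (_ , eb) = trans ea (trans eq (sym eb))
    ... | inj₁ (Wa , _) | inj₂ (¬Wb , _) = contradiction (W-fibre-closed adj eq Wa) ¬Wb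
    ... | inj₂ (¬Wa , _) | inj₁ (Wb , _) = contradiction (W-fibre-closed (swap adj) (sym eq) Wb) ¬Wa

    ρ′-fibre⁻ : ∀ {a b} → Adj (Arc G) a b → ρ′ a ≡ ρ′ b → ξ a ≡ ξ b
    ρ′-fibre⁻ {a} {b} adj eq with Relabels.at rel a | Relabels.at rel b
    ... | inj₁ (_ , x , ea) | inj₁ (_ , x′ , eb) = β-injective (trans (sym ea) (trans eq eb))
    ... | inj₂ (_ , ea) | inj₂ (_ , eb) = trans (sym ea) (trans eq eb)
    ... | inj₁ (_ , x , ea) | inj₂ (_ , eb) = fibre-from-β x adj (trans (sym eb) (trans (sym eq) ea))
    ... | inj₂ (_ , ea) | inj₁ (_ , x′ , eb) = sym (fibre-from-β x′ (swap adj) (trans (sym ea) (trans eq eb)))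

    Γ-preserved : ∀ {v w} → InΓ (Arc G) ρ′ v w ⇔ InΓ (Arc G) ξ v w
    Γ-preserved = mk⇔ (InΓ-transfer ρ′-fibre⁻) (InΓ-transfer ρ′-fibre⁺)

    W⇔U′Γ : ∀ {v} → W v ⇔ U′Γ G ρ′ v
    W⇔U′Γ {v} = mk⇔ W⇒U′Γ U′Γ⇒W
      where
      W⇒U′Γ : W v → U′Γ G ρ′ v
      W⇒U′Γ Wv with Relabels.at rel v | W⇒UΓ Wv
      ... | inj₁ (_ , x , ev) | _ , u , r , h =
        subst (T ∘ Y) (sym ev) (proj₂ (β _)) , u , from Γ-preserved r , from (relabel-HitsM rel) h
      ... | inj₂ (¬Wv , _) | _ = contradiction Wv ¬Wv

      U′Γ⇒W : U′Γ G ρ′ v → W v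
      U′Γ⇒W (y , u , r , h) with Relabels.at rel v
      ... | inj₁ (Wv , _) = Wv
      ... | inj₂ (_ , ev) =
        ⊥-elim (Y-¬hitsM (subst (T ∘ Y) (trans ev (sym (InΓ-fibre (to Γ-preserved r)))) y)
                             (to (relabel-HitsM rel) h))

  module StrictCase (G : Digraph) (ξ : Vtx G → Z) (strict : IsStrict (Arc G) AR ξ) =
    Relabelling G ξ (proj₁ strict) (U G ξ) (ρ G ξ) ρ-relabels id U⇒UΓ
                (λ adj eq Ua → subst (U G ξ) (strict-fibre-adj {F = AR} strict adj eq) Ua)

  module HomCase (G : Digraph) (ξ : Vtx G → Z) (hom : IsHom (Arc G) AR ξ) =
    Relabelling G ξ hom (UΓ G ξ) (ρΓ G ξ) ρΓ-relabels U⇒UΓ id UΓ-fibre-closed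

  module _ (G : Digraph) (ξ : Vtx G → Z) (strict : IsStrict (Arc G) AR ξ) where
    open StrictCase G ξ strict

    ρ-strict : IsStrict (Arc G) AS (ρ G ξ)
    ρ-strict = ρ′-hom , λ v w e v≢w eq → proj₂ strict v w e v≢w (ρ′-fibre⁻ (inj₁ e) eq)

    U⇔U′ : ∀ {v} → U G ξ v ⇔ U′ G (ρ G ξ) v
    U⇔U′ = mk⇔ (to (U′Γ⇔U′ {F = AS} ρ-strict) ∘ to W⇔U′Γ) (from W⇔U′Γ ∘ from (U′Γ⇔U′ {F = AS} ρ-strict))

    ρ-recover-β : ∀ v → (u : U′ G (ρ G ξ) v) → ξ v ≡ proj₁ (β⁻¹ bij (ρ G ξ v , proj₁ u))
    ρ-recover-β v u = relabel-recover-β ρ-relabels (from U⇔U′ u) (proj₁ u)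

    ρ-recover-id : ∀ v → ¬ U′ G (ρ G ξ) v → ξ v ≡ ρ G ξ v
    ρ-recover-id v ¬U′ = relabel-recover-id ρ-relabels (¬U′ ∘ to U⇔U′)

  ρ-injective : (G : Digraph) (ξ₁ ξ₂ : Vtx G → Z) → IsStrict (Arc G) AR ξ₁ → IsStrict (Arc G) AR ξ₂ →
                (∀ v → ρ G ξ₁ v ≡ ρ G ξ₂ v) → ∀ v → ξ₁ v ≡ ξ₂ v
  ρ-injective G ξ₁ ξ₂ s₁ s₂ =
    relabel-injective ρ-relabels ρ-relabels (StrictCase.W⇔U′Γ G ξ₁ s₁) (StrictCase.W⇔U′Γ G ξ₂ s₂)

  AR⊑ΓAS : AR ⊑Γ AS
  AR⊑ΓAS G =
      (λ (ξ , hom) → ρΓ G ξ , HomCase.ρ′-hom G ξ hom)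
    , (λ (ξ₁ , hom₁) (ξ₂ , hom₂) →
         relabel-injective ρΓ-relabels ρΓ-relabels (HomCase.W⇔U′Γ G ξ₁ hom₁) (HomCase.W⇔U′Γ G ξ₂ hom₂))
    , (λ (ξ , hom) v w → HomCase.Γ-preserved G ξ hom)

theorem3 : (R : Digraph) (X M Y : Sub (Digraph.size R)) →
    (∀ z → T (X z) → ¬ T (M z)) →
    (∀ z → T (M z) → ¬ T (Y z)) →
    (∀ y m → T (Y y) → T (M m) → ¬ InN (Arc R) y m) →
    (β : ⟨ X ⟩ → ⟨ Y ⟩) →
    (bij : Bijective _≡_ _≡_ β) →
    (∀ x x′ → Arc R (proj₁ x) (proj₁ x′) → Arc R (proj₁ (β x)) (proj₁ (β x′))) →
    (∀ (x : ⟨ X ⟩) u → InNin (Arc R) (proj₁ x) u → ¬ T (M u) → InNin (Arc R) (proj₁ (β x)) u) →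
    (∀ (x : ⟨ X ⟩) u → InNout (Arc R) (proj₁ x) u → ¬ T (M u) → InNout (Arc R) (proj₁ (β x)) u) →
    let open Construction R X M Y β in
    ((G : Digraph) (ξ : Vtx G → Z) → IsStrict (Arc G) AR ξ →
        IsStrict (Arc G) AS (ρ G ξ)
      × (∀ v → (u : U′ G (ρ G ξ) v) → ξ v ≡ proj₁ (β⁻¹ bij (ρ G ξ v , proj₁ u)))
      × (∀ v → ¬ U′ G (ρ G ξ) v → ξ v ≡ ρ G ξ v))
    × ((G : Digraph) (ξ₁ ξ₂ : Vtx G → Z) → IsStrict (Arc G) AR ξ₁ → IsStrict (Arc G) AR ξ₂ →
        (∀ v → ρ G ξ₁ v ≡ ρ G ξ₂ v) → ∀ v → ξ₁ v ≡ ξ₂ v)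
    × (AR ⊑Γ AS)
theorem3 R X M Y X∩M≡∅ M∩Y≡∅ M∩N[Y]≡∅ β bij β-hom β-Nin β-Nout =
    (λ G ξ strict → ρ-strict G ξ strict , ρ-recover-β G ξ strict , ρ-recover-id G ξ strict)
  , ρ-injective
  , AR⊑ΓAS
  where open Rerouting R X M Y X∩M≡∅ M∩Y≡∅ M∩N[Y]≡∅ β bij β-hom β-Nin β-Nout
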